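{- Let $n$ be a positive integer. There exists a bijection $\varphi:\Pi_n\to\Sigma_{n^2}$ such that for all $P,Q\in\Pi_n$, the matrices $P$ and $Q$ are disjoint if and only if $\varphi(P)$ and $\varphi(Q)$ are disjoint.
   Context: For a positive integer $n$, let $\Pi_n$ denote the set of all $(2n)\times n$ matrices in which every row is a permutation of all elements of $\{1,2,\ldots,n\}$. Two matrices $C=(c_{ij}),D=(d_{ij})\in\Pi_n$ are called disjoint if there are no $s,t\in\{1,\ldots,n\}$ such that the ordered pair $\langle c_{st},c_{n+t,\,s}\rangle$ equals the ordered pair $\langle d_{st},d_{n+t,\,s}\rangle$. An $n^2\times n^2$ binary (0/1) matrix $A$ is divided by $n-1$ horizontal and $n-1$ vertical lines into $n^2$ non-intersecting $n\times n$ blocks $A_{kl}$, $1\le k,l\le n$, where $A_{kl}$ consists of rows $(k-1)n+1,\ldots,kn$ and columns $(l-1)n+1,\ldots,ln$ of $A$. Such an $A$ is called an S-permutation matrix if each row, each column, and each block $A_{kl}$ contains exactly one entry equal to $1$. $\Sigma_{n^2}$ denotes the set of all $n^2\times n^2$ S-permutation matrices. Two matrices $A=(a_{ij}),B=(b_{ij})\in\Sigma_{n^2}$ are called disjoint if there are no indices $i,j$ with $a_{ij}=b_{ij}=1$. -}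

module Defs where

open import Data.Nat using (ℕ; _+_; _*_)
open import Data.Fin using (Fin; _↑ˡ_; _↑ʳ_; combine)
open import Data.Bool using (Bool; true)
open import Data.Vec using (Vec; lookup)
open import Data.Vec.Membership.Propositional using (_∈_)
open import Data.Product using (Σ; ∃; ∃-syntax; _×_; _,_; proj₁; proj₂)
open import Relation.Binary.PropositionalEquality using (_≡_)
open import Relation.Nullary using (¬_)

-- All indices are 0-based: Fin n = {0,…,n-1} stands for {1,…,n}.

IsPermRow : (n : ℕ) → Vec (Fin n) n → Set
IsPermRow n r = (∀ x → x ∈ r) × (∀ i j → lookup r i ≡ lookup r j → i ≡ j)

PiMat : ℕ → Set
PiMat n = Vec (Vec (Fin n) n) (n + n)

Pi : ℕ → Set
Pi n = Σ (PiMat n) λ C → ∀ i → IsPermRow n (lookup C i)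

entry : ∀ {n} → PiMat n → Fin (n + n) → Fin n → Fin n
entry C i j = lookup (lookup C i) j

DisjointPi : ∀ {n} → PiMat n → PiMat n → Set
DisjointPi {n} C D =
  ¬ (∃[ s ] ∃[ t ]
      (entry C (s ↑ˡ n) t ≡ entry D (s ↑ˡ n) t
       × entry C (n ↑ʳ t) s ≡ entry D (n ↑ʳ t) s))

-- Binary n² × n² matrices, entries 0/1 as Bool (true = 1).
BinMat : ℕ → Set
BinMat n = Vec (Vec Bool (n * n)) (n * n)

bentry : ∀ n → BinMat n → Fin (n * n) → Fin (n * n) → Bool
bentry n A i j = lookup (lookup A i) j

ExactlyOne : {I : Set} → (I → Bool) → Set
ExactlyOne {I} f = ∃[ i ] (f i ≡ true × (∀ j → f j ≡ true → j ≡ i))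

-- S-permutation matrix. Row k*n+i of A is  combine k i  (0-based), so the
-- block A_{kl} consists of entries (combine k i , combine l j), i,j : Fin n.
IsSPerm : (n : ℕ) → BinMat n → Set
IsSPerm n A =
    (∀ i → ExactlyOne {Fin (n * n)} (λ j → bentry n A i j))
  × (∀ j → ExactlyOne {Fin (n * n)} (λ i → bentry n A i j))
  × (∀ (k l : Fin n) →
       ExactlyOne {Fin n × Fin n}
         (λ p → bentry n A (combine k (proj₁ p)) (combine l (proj₂ p))))

Sigma : ℕ → Set
Sigma n = Σ (BinMat n) (IsSPerm n)

DisjointSigma : ∀ n → BinMat n → BinMat n → Set
DisjointSigma n A B = ¬ (∃[ i ] ∃[ j ] (bentry n A i j ≡ true × bentry n B i j ≡ true))

-- A matrix of Σ_{n²} is determined by where the single 1 of each block A_{kl} sits, i.e. by a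
-- placement (k , l) ↦ (i , j) ∈ Fin n × Fin n; the row and column conditions say exactly that
-- i depends bijectively on l for fixed k, and j bijectively on k for fixed l. A matrix C of Π_n
-- gives such a placement by (k , l) ↦ (c_{kl} , c_{n+l,k}), its rows being the required
-- bijections, and every placement arises from a unique C. Two matrices of either kind are
-- disjoint exactly when their placements differ in every block.
module Submission where

open import Defs
open import Data.Nat using (ℕ; _≤_; _+_; _*_)
open import Data.Bool using (Bool; true; false)
open import Data.Bool.Properties using (T-≡)
open import Data.Fin using (Fin; _↑ˡ_; _↑ʳ_; combine; remQuot; splitAt; _≟_)
open import Data.Fin.Properties
  using (combine-surjective; combine-injectiveˡ; remQuot-combine; splitAt⁻¹-↑ˡ; splitAt⁻¹-↑ʳ)
open import Data.Product using (Σ; ∃-syntax; _×_; proj₁; proj₂; _,_)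
open import Data.Product.Properties using (≡-dec; ×-≡,≡→≡; ×-≡,≡←≡)
open import Data.Sum using (inj₁; inj₂)
open import Data.Vec using (Vec; lookup; tabulate; _++_)
open import Data.Vec.Properties using (lookup∘tabulate; lookup-++ˡ; lookup-++ʳ)
open import Data.Vec.Relation.Binary.Pointwise.Extensional using (ext; Pointwise-≡⇒≡)
open import Data.Vec.Membership.Propositional using (_∈_)
open import Data.Vec.Membership.Propositional.Properties using (∈-tabulate⁺)
open import Data.Vec.Relation.Unary.Any using (index)
open import Data.Vec.Relation.Unary.Any.Properties using (lookup-index)
open import Function.Bundles using (_⇔_; mk⇔; Equivalence)
open import Function.Definitions using (Injective; StrictlySurjective)
open import Function.Properties.Equivalence using () renaming (trans to ⇔-trans; sym to ⇔-sym)
open import Relation.Binary.PropositionalEquality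
open import Relation.Nullary using (¬_; Dec)
open import Relation.Nullary.Decidable using (isYes; toWitness; fromWitness)

open Equivalence using (to; from)

lookup-ext : ∀ {A : Set} {m} {u v : Vec A m} → (∀ i → lookup u i ≡ lookup v i) → u ≡ v
lookup-ext u≗v = Pointwise-≡⇒≡ (ext u≗v)

combine-elim : ∀ {m n} (P : Fin (m * n) → Set) → (∀ k i → P (combine k i)) → ∀ r → P r
combine-elim {m} {n} P h r with k , i , refl ← combine-surjective {m} {n} r = h k i

↑-elim : ∀ {m n} (P : Fin (m + n) → Set) →
  (∀ k → P (k ↑ˡ n)) → (∀ l → P (m ↑ʳ l)) → ∀ r → P r
↑-elim {m} P hˡ hʳ r with splitAt m r in eq
... | inj₁ k = subst P (splitAt⁻¹-↑ˡ eq) (hˡ k)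
... | inj₂ l = subst P (splitAt⁻¹-↑ʳ eq) (hʳ l)

isYes≡true⇔ : ∀ {P : Set} (p? : Dec P) → isYes p? ≡ true ⇔ P
isYes≡true⇔ p? = ⇔-trans (⇔-sym T-≡) (mk⇔ toWitness fromWitness)

Bool-ext : ∀ {a b : Bool} → a ≡ true ⇔ b ≡ true → a ≡ b
Bool-ext {false} {false} _   = refl
Bool-ext {false} {true}  a⇔b = a⇔b .from refl
Bool-ext {true}          a⇔b = sym (a⇔b .to refl)

exactlyOne-unique : ∀ {I : Set} {f : I → Bool} → ExactlyOne f →
  ∀ {a b} → f a ≡ true → f b ≡ true → a ≡ b
exactlyOne-unique (_ , _ , only) fa fb = trans (only _ fa) (sym (only _ fb))

IsPermutation : ∀ {n} → (Fin n → Fin n) → Set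
IsPermutation f = StrictlySurjective _≡_ f × Injective _≡_ _≡_ f

IsPermRow⇒IsPermutation : ∀ {n} {r : Vec (Fin n) n} → IsPermRow n r → IsPermutation (lookup r)
IsPermRow⇒IsPermutation (all∈ , inj) = (λ x → index (all∈ x) , sym (lookup-index (all∈ x))) , inj _ _

IsPermutation⇒IsPermRow : ∀ {n} {f : Fin n → Fin n} → IsPermutation f → IsPermRow n (tabulate f)
IsPermutation⇒IsPermRow {f = f} (surj , inj) = all∈ , λ i j e →
  inj (trans (sym (lookup∘tabulate f i)) (trans e (lookup∘tabulate f j)))
  where
  all∈ : ∀ x → x ∈ tabulate f
  all∈ x with i , refl ← surj x = ∈-tabulate⁺ f i

module _ {n : ℕ} where

  -- pos k l is the position, inside block A_{kl}, of the block's single 1.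
  Placement : Set
  Placement = Fin n → Fin n → Fin n × Fin n

  IsPermPlacement : Placement → Set
  IsPermPlacement pos =
      (∀ k → IsPermutation (λ l → proj₁ (pos k l)))
    × (∀ l → IsPermutation (λ k → proj₂ (pos k l)))

  Overlapping : Placement → Placement → Set
  Overlapping pos pos′ = ∃[ k ] ∃[ l ] pos k l ≡ pos′ k l

  record Represents (pos : Placement) (A : BinMat n) : Set where
    field
      one⇒pos : ∀ k i l j → bentry n A (combine k i) (combine l j) ≡ true → pos k l ≡ (i , j)
      pos⇒one : ∀ k i l j → pos k l ≡ (i , j) → bentry n A (combine k i) (combine l j) ≡ true

  open Represents

  placementBit : Placement → Fin n × Fin n → Fin n × Fin n → Bool
  placementBit pos (k , i) (l , j) = isYes (≡-dec _≟_ _≟_ (pos k l) (i , j))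

  posMat : Placement → BinMat n
  posMat pos = tabulate λ r → tabulate λ c → placementBit pos (remQuot n r) (remQuot n c)

  posMat-represents : ∀ pos → Represents pos (posMat pos)
  posMat-represents pos = record
    { one⇒pos = λ k i l j one → bit⇔ k i l j .to (trans (sym (posMat-entry k i l j)) one)
    ; pos⇒one = λ k i l j e → trans (posMat-entry k i l j) (bit⇔ k i l j .from e)
    }
    where
    bit⇔ : ∀ k i l j → placementBit pos (k , i) (l , j) ≡ true ⇔ pos k l ≡ (i , j)
    bit⇔ k i l j = isYes≡true⇔ (≡-dec _≟_ _≟_ (pos k l) (i , j))

    row : Fin (n * n) → Vec Bool (n * n)
    row r = tabulate λ c → placementBit pos (remQuot n r) (remQuot n c)

    posMat-entry : ∀ k i l j → bentry n (posMat pos) (combine k i) (combine l j)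
                             ≡ placementBit pos (k , i) (l , j)
    posMat-entry k i l j = begin
      lookup (lookup (posMat pos) (combine k i)) (combine l j)
        ≡⟨ cong (λ v → lookup v (combine l j)) (lookup∘tabulate row (combine k i)) ⟩
      lookup (row (combine k i)) (combine l j)
        ≡⟨ lookup∘tabulate _ (combine l j) ⟩
      placementBit pos (remQuot n (combine k i)) (remQuot n (combine l j))
        ≡⟨ cong₂ (placementBit pos) (remQuot-combine k i) (remQuot-combine l j) ⟩
      placementBit pos (k , i) (l , j)
        ∎
      where open ≡-Reasoning

  module _ {pos : Placement} {A : BinMat n} (rep : Represents pos A) where

    represents-one : ∀ k l →
      bentry n A (combine k (proj₁ (pos k l))) (combine l (proj₂ (pos k l))) ≡ true
    represents-one k l = pos⇒one rep k _ l _ refl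

    represents-rows : (∀ r → ExactlyOne (bentry n A r))
                    ⇔ (∀ k → IsPermutation (λ l → proj₁ (pos k l)))
    represents-rows = mk⇔ rows⇒perm perm⇒rows
      where
      rows⇒perm : (∀ r → ExactlyOne (bentry n A r)) → ∀ k → IsPermutation (λ l → proj₁ (pos k l))
      rows⇒perm rows k = surj , inj
        where
        surj : StrictlySurjective _≡_ (λ l → proj₁ (pos k l))
        surj i with rows (combine k i)
        ... | c , one , _ with combine-surjective {n} {n} c
        ... | l , j , refl = l , cong proj₁ (one⇒pos rep k i l j one)
        inj : Injective _≡_ _≡_ (λ l → proj₁ (pos k l))
        inj {l} {l′} e = combine-injectiveˡ l _ l′ _ (exactlyOne-unique (rows _)
          (represents-one k l) (pos⇒one rep k _ l′ _ (×-≡,≡→≡ (sym e , refl))))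

      perm⇒rows : (∀ k → IsPermutation (λ l → proj₁ (pos k l))) → ∀ r → ExactlyOne (bentry n A r)
      perm⇒rows perm = combine-elim _ row
        where
        row : ∀ k i → ExactlyOne (bentry n A (combine k i))
        row k i with l , refl ← proj₁ (perm k) i =
          combine l (proj₂ (pos k l)) , represents-one k l , combine-elim _ only
          where
          only : ∀ l′ j′ → bentry n A (combine k (proj₁ (pos k l))) (combine l′ j′) ≡ true →
                 combine l′ j′ ≡ combine l (proj₂ (pos k l))
          only l′ j′ one′ with refl ← proj₂ (perm k) (cong proj₁ (one⇒pos rep k _ l′ j′ one′)) =
            cong (combine l′) (sym (cong proj₂ (one⇒pos rep k _ l′ j′ one′)))

    represents-cols : (∀ c → ExactlyOne (λ r → bentry n A r c))
                    ⇔ (∀ l → IsPermutation (λ k → proj₂ (pos k l)))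
    represents-cols = mk⇔ cols⇒perm perm⇒cols
      where
      cols⇒perm : (∀ c → ExactlyOne (λ r → bentry n A r c)) → ∀ l → IsPermutation (λ k → proj₂ (pos k l))
      cols⇒perm cols l = surj , inj
        where
        surj : StrictlySurjective _≡_ (λ k → proj₂ (pos k l))
        surj j with cols (combine l j)
        ... | r , one , _ with combine-surjective {n} {n} r
        ... | k , i , refl = k , cong proj₂ (one⇒pos rep k i l j one)
        inj : Injective _≡_ _≡_ (λ k → proj₂ (pos k l))
        inj {k} {k′} e = combine-injectiveˡ k _ k′ _ (exactlyOne-unique (cols _)
          (represents-one k l) (pos⇒one rep k′ _ l _ (×-≡,≡→≡ (refl , sym e))))

      perm⇒cols : (∀ l → IsPermutation (λ k → proj₂ (pos k l))) → ∀ c → ExactlyOne (λ r → bentry n A r c)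
      perm⇒cols perm = combine-elim _ col
        where
        col : ∀ l j → ExactlyOne (λ r → bentry n A r (combine l j))
        col l j with k , refl ← proj₁ (perm l) j =
          combine k (proj₁ (pos k l)) , represents-one k l , combine-elim _ only
          where
          only : ∀ k′ i′ → bentry n A (combine k′ i′) (combine l (proj₂ (pos k l))) ≡ true →
                 combine k′ i′ ≡ combine k (proj₁ (pos k l))
          only k′ i′ one′ with refl ← proj₂ (perm l) (cong proj₂ (one⇒pos rep k′ i′ l _ one′)) =
            cong (combine k′) (sym (cong proj₁ (one⇒pos rep k′ i′ l _ one′)))

    represents-blocks : ∀ k l →
      ExactlyOne (λ p → bentry n A (combine k (proj₁ p)) (combine l (proj₂ p)))
    represents-blocks k l = pos k l , represents-one k l , λ p one → sym (one⇒pos rep k _ l _ one)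

    represents-isSPerm : IsPermPlacement pos → IsSPerm n A
    represents-isSPerm (rowPerm , colPerm) =
      represents-rows .from rowPerm , represents-cols .from colPerm , represents-blocks

  blockPlacement : Sigma n → Placement
  blockPlacement (_ , _ , _ , blocks) k l = proj₁ (blocks k l)

  blockPlacement-represents : ∀ B → Represents (blockPlacement B) (proj₁ B)
  blockPlacement-represents (_ , _ , _ , blocks) = record
    { one⇒pos = λ k i l j one → sym (proj₂ (proj₂ (blocks k l)) (i , j) one)
    ; pos⇒one = λ { k i l j refl → proj₁ (proj₂ (blocks k l)) }
    }

  blockPlacement-isPermPlacement : ∀ B → IsPermPlacement (blockPlacement B)
  blockPlacement-isPermPlacement B@(_ , rows , cols , _) =
    represents-rows rep .to rows , represents-cols rep .to cols
    where
    rep : Represents (blockPlacement B) (proj₁ B)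
    rep = blockPlacement-represents B

  represents-unique : ∀ {pos pos′ A B} → Represents pos A → Represents pos′ B →
    (∀ k l → pos k l ≡ pos′ k l) → A ≡ B
  represents-unique rep rep′ pos≗pos′ =
    lookup-ext (combine-elim _ λ k i → lookup-ext (combine-elim _ λ l j → Bool-ext (mk⇔
      (λ one → pos⇒one rep′ k i l j (trans (sym (pos≗pos′ k l)) (one⇒pos rep k i l j one)))
      (λ one → pos⇒one rep k i l j (trans (pos≗pos′ k l) (one⇒pos rep′ k i l j one))))))

  represents-injective : ∀ {pos pos′ A} → Represents pos A → Represents pos′ A →
    ∀ k l → pos k l ≡ pos′ k l
  represents-injective rep rep′ k l = sym (one⇒pos rep′ k _ l _ (represents-one rep k l))

  represents-disjoint : ∀ {pos pos′ A B} → Represents pos A → Represents pos′ B →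
    DisjointSigma n A B ⇔ (¬ Overlapping pos pos′)
  represents-disjoint {pos} {pos′} {A} {B} rep rep′ = mk⇔ to′ from′
    where
    to′ : DisjointSigma n A B → ¬ Overlapping pos pos′
    to′ disj (k , l , e) = disj (_ , _ , represents-one rep k l , pos⇒one rep′ k _ l _ (sym e))
    from′ : (¬ Overlapping pos pos′) → DisjointSigma n A B
    from′ disj (r , c , oneA , oneB) with combine-surjective {n} {n} r | combine-surjective {n} {n} c
    ... | k , i , refl | l , j , refl =
      disj (k , l , trans (one⇒pos rep k i l j oneA) (sym (one⇒pos rep′ k i l j oneB)))

  piPlacement : PiMat n → Placement
  piPlacement C k l = entry C (k ↑ˡ n) l , entry C (n ↑ʳ l) k

  piPlacement-isPermPlacement : ∀ C → (∀ r → IsPermRow n (lookup C r)) →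
    IsPermPlacement (piPlacement C)
  piPlacement-isPermPlacement _ rows =
    (λ k → IsPermRow⇒IsPermutation (rows (k ↑ˡ n))) ,
    (λ l → IsPermRow⇒IsPermutation (rows (n ↑ʳ l)))

  piPlacement-injective : ∀ C D → (∀ k l → piPlacement C k l ≡ piPlacement D k l) → C ≡ D
  piPlacement-injective _ _ C≗D = lookup-ext (↑-elim _
    (λ k → lookup-ext λ l → cong proj₁ (C≗D k l))
    (λ l → lookup-ext λ k → cong proj₂ (C≗D k l)))

  piPlacement-disjoint : ∀ C D → DisjointPi C D ⇔ (¬ Overlapping (piPlacement C) (piPlacement D))
  piPlacement-disjoint _ _ = mk⇔
    (λ disj (k , l , e) → disj (k , l , ×-≡,≡←≡ e))
    (λ disj (k , l , e) → disj (k , l , ×-≡,≡→≡ e))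

  module _ (pos : Placement) where

    placementMatˡ placementMatʳ : Vec (Vec (Fin n) n) n
    placementMatˡ = tabulate λ k → tabulate λ l → proj₁ (pos k l)
    placementMatʳ = tabulate λ l → tabulate λ k → proj₂ (pos k l)

    placementMat : PiMat n
    placementMat = placementMatˡ ++ placementMatʳ

    placementMat-↑ˡ : ∀ k → lookup placementMat (k ↑ˡ n) ≡ tabulate (λ l → proj₁ (pos k l))
    placementMat-↑ˡ k = trans (lookup-++ˡ placementMatˡ placementMatʳ k) (lookup∘tabulate _ k)

    placementMat-↑ʳ : ∀ l → lookup placementMat (n ↑ʳ l) ≡ tabulate (λ k → proj₂ (pos k l))
    placementMat-↑ʳ l = trans (lookup-++ʳ placementMatˡ placementMatʳ l) (lookup∘tabulate _ l)

    placementMat-rows : IsPermPlacement pos → ∀ r → IsPermRow n (lookup placementMat r)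
    placementMat-rows (rowPerm , colPerm) = ↑-elim _
      (λ k → subst (IsPermRow n) (sym (placementMat-↑ˡ k)) (IsPermutation⇒IsPermRow (rowPerm k)))
      (λ l → subst (IsPermRow n) (sym (placementMat-↑ʳ l)) (IsPermutation⇒IsPermRow (colPerm l)))

    piPlacement-placementMat : ∀ k l → piPlacement placementMat k l ≡ pos k l
    piPlacement-placementMat k l = ×-≡,≡→≡
      ( trans (cong (λ v → lookup v l) (placementMat-↑ˡ k)) (lookup∘tabulate _ l)
      , trans (cong (λ v → lookup v k) (placementMat-↑ʳ l)) (lookup∘tabulate _ k) )

theorem1 : (n : ℕ) → 1 ≤ n →
    Σ (Pi n → Sigma n) λ φ →
        (∀ P Q → proj₁ (φ P) ≡ proj₁ (φ Q) → proj₁ P ≡ proj₁ Q)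
      × ((B : Sigma n) → ∃[ P ] (proj₁ (φ P) ≡ proj₁ B))
      × (∀ P Q → DisjointPi (proj₁ P) (proj₁ Q) ⇔ DisjointSigma n (proj₁ (φ P)) (proj₁ (φ Q)))
theorem1 n _ = φ , φ-injective , φ-surjective , φ-disjoint
  where
  φ : Pi n → Sigma n
  φ (C , rows) = posMat (piPlacement C) ,
    represents-isSPerm (posMat-represents _) (piPlacement-isPermPlacement C rows)

  φ-injective : ∀ P Q → proj₁ (φ P) ≡ proj₁ (φ Q) → proj₁ P ≡ proj₁ Q
  φ-injective (C , _) (D , _) e = piPlacement-injective C D (represents-injective
    (posMat-represents _) (subst (Represents _) (sym e) (posMat-represents _)))

  φ-surjective : (B : Sigma n) → ∃[ P ] (proj₁ (φ P) ≡ proj₁ B)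
  φ-surjective B = (placementMat pos , placementMat-rows pos (blockPlacement-isPermPlacement B)) ,
    represents-unique (posMat-represents _) (blockPlacement-represents B) (piPlacement-placementMat pos)
    where
    pos : Placement
    pos = blockPlacement B

  φ-disjoint : ∀ P Q → DisjointPi (proj₁ P) (proj₁ Q) ⇔ DisjointSigma n (proj₁ (φ P)) (proj₁ (φ Q))
  φ-disjoint (C , _) (D , _) = ⇔-trans (piPlacement-disjoint C D)
    (⇔-sym (represents-disjoint (posMat-represents _) (posMat-represents _)))
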